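{- For any finitely generated group $H$, the set $\mathcal E_H=\{G\in\mathcal G:\ H\text{ is embeddable into }\overline G\}$ is $F_\sigma$ in $\mathcal G$.
   Context: Let $\mathbb N=\{1,2,3,\dots\}$. Equip $\mathbb N^{\mathbb N\times\mathbb N}$ with the product of the discrete topologies. Let $\mathcal G$ be the subspace consisting of tables that are the multiplication table of a group on $\mathbb N$ with identity element $1$ (subspace topology). For $G\in\mathcal G$, $\overline G$ denotes the group on $\mathbb N$ with multiplication table $G$. -}

module Defs where

open import Level using (Level; _⊔_) renaming (zero to 0ℓ)
open import Data.Nat using (ℕ; zero; suc; _<_)
open import Data.Fin using (Fin)
open import Data.Bool using (Bool; true; false)
open import Data.List using (List; []; _∷_)
open import Data.Product using (Σ; ∃; ∃-syntax; _×_; _,_)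
open import Relation.Binary.PropositionalEquality using (_≡_)
open import Function.Bundles using (_⇔_)
open import Algebra.Bundles using (Group)

-- Convention: the paper's ℕ = {1,2,3,…} is represented by Agda's ℕ = {0,1,2,…}
-- via n ↦ n - 1; the identity element 1 thus becomes 0.

Table : Set
Table = ℕ → ℕ → ℕ

record IsGroupTable (T : Table) : Set where
  field
    assoc    : ∀ a b c → T (T a b) c ≡ T a (T b c)
    identityˡ : ∀ a → T 0 a ≡ a
    identityʳ : ∀ a → T a 0 ≡ a
    inverse  : ∀ a → ∃[ b ] (T a b ≡ 0 × T b a ≡ 0)

-- Two tables agree on the finite square {0,…,n-1}²
-- (the basic open neighbourhoods of the product of discrete topologies
--  are cylinders over finitely many coordinates; these squares give a
--  neighbourhood basis).
AgreeOn : ℕ → Table → Table → Set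
AgreeOn n S T = ∀ i j → i < n → j < n → S i j ≡ T i j

-- A set P of tables is closed in the subspace 𝒢: it contains every point of
-- 𝒢 which lies in the closure (in 𝒢) of P ∩ 𝒢, i.e. every point of 𝒢 all of
-- whose basic neighbourhoods meet P ∩ 𝒢.
IsClosedIn𝒢 : ∀ {a} → (Table → Set a) → Set a
IsClosedIn𝒢 P =
  ∀ T → IsGroupTable T →
    (∀ n → ∃[ S ] (IsGroupTable S × P S × AgreeOn n S T)) → P T

IsFσIn𝒢 : ∀ {a} → (Table → Set a) → Set (Level.suc a)
IsFσIn𝒢 {a} E =
  Σ (ℕ → Table → Set a) λ C →
    (∀ n → IsClosedIn𝒢 (C n)) ×
    (∀ T → IsGroupTable T → (E T ⇔ (∃[ n ] C n T)))

-- Words in k generators and their inverses (Bool = true : the generator,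
-- false : its inverse), and their evaluation in a group.
module _ {c ℓ : Level} (H : Group c ℓ) where
  open Group H

  evalWord : ∀ {k} → (Fin k → Carrier) → List (Fin k × Bool) → Carrier
  evalWord g []                  = ε
  evalWord g ((i , true)  ∷ w)   = g i ∙ evalWord g w
  evalWord g ((i , false) ∷ w)   = (g i) ⁻¹ ∙ evalWord g w

  FinitelyGenerated : Set (c ⊔ ℓ)
  FinitelyGenerated =
    ∃[ k ] Σ (Fin k → Carrier) λ g →
      ∀ x → ∃[ w ] (x ≈ evalWord g w)

  record IsEmbeddingInto (T : Table) (f : Carrier → ℕ) : Set (c ⊔ ℓ) where
    field
      respects  : ∀ {x y} → x ≈ y → f x ≡ f y
      homo      : ∀ x y → f (x ∙ y) ≡ T (f x) (f y)
      injective : ∀ {x y} → f x ≡ f y → x ≈ y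

  EmbeddableInto : Table → Set (c ⊔ ℓ)
  EmbeddableInto T = Σ (Carrier → ℕ) (IsEmbeddingInto T)

  ℰ : Table → Set (c ⊔ ℓ)
  ℰ = EmbeddableInto

{-# OPTIONS --safe #-}
module Submission where

open import Defs
open import Level using () renaming (zero to 0ℓ; _⊔_ to _⊔ˡ_)
open import Algebra.Bundles using (Group)
open import Algebra.Morphism.Structures using (IsMagmaHomomorphism)
import Algebra.Properties.Group as GroupProperties
open import Axiom.ExcludedMiddle using (ExcludedMiddle)
open import Data.Nat using (ℕ; zero; suc; _+_; _⊔_; _≤_; s≤s)
open import Data.Nat.Properties using (+-identityʳ; +-suc; ≤-refl; ≤-trans; m≤m⊔n; m≤n⊔m)
open import Data.Fin using (Fin)
import Data.Fin as Fin
open import Data.Bool using (Bool; true; false)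
open import Data.List using (List; []; _∷_)
open import Data.Product using (Σ; ∃; ∃-syntax; _×_; _,_; proj₁; proj₂)
open import Function.Base using (_∘_)
open import Function.Bundles using (mk⇔)
import Relation.Binary.Reasoning.Setoid as SetoidReasoning
open import Relation.Binary.PropositionalEquality
  using (_≡_; refl; sym; trans; cong; cong₂; subst; isEquivalence; module ≡-Reasoning)

-- An embedding f of H into a group table T is
-- determined by the tuple a = (f g₁,…,f g_k) ∈ ℕᵏ: f sends the element named
-- by a word w to the value of w at a in T.  Hence ℰ_H is the countable union,
-- over a ∈ ℕᵏ, of the sets of tables admitting an embedding with f gᵢ = aᵢ.
-- Each of these is closed: the value of a word at a is a continuous function
-- of the table, so if T is a limit of such tables Sₙ with embeddings fₙ,
-- the maps fₙ converge pointwise to the map f defined by T, and every identity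
-- making fₙ an embedding involves only finitely many entries, hence passes to
-- the limit.

step : ℕ × ℕ → ℕ × ℕ
step (zero  , y) = (suc y , 0)
step (suc x , y) = (x , suc y)

unpair : ℕ → ℕ × ℕ
unpair zero    = (0 , 0)
unpair (suc n) = step (unpair n)

Enumerated : ℕ × ℕ → Set
Enumerated p = ∃[ n ] unpair n ≡ p

enumerated-step : ∀ {p} → Enumerated p → Enumerated (step p)
enumerated-step (n , unpair-n≡p) = suc n , cong step unpair-n≡p

enumerated-antidiagonal : ∀ y x → Enumerated (x + y , 0) → Enumerated (x , y)
enumerated-antidiagonal zero    x e rewrite +-identityʳ x = e
enumerated-antidiagonal (suc y) x e =
  enumerated-step (enumerated-antidiagonal y (suc x) (subst (λ s → Enumerated (s , 0)) (+-suc x y) e))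

enumerated-axis : ∀ s → Enumerated (s , 0)
enumerated-axis zero    = 0 , refl
enumerated-axis (suc s) = enumerated-step (enumerated-antidiagonal s 0 (enumerated-axis s))

unpair-surjective : ∀ x y → Enumerated (x , y)
unpair-surjective x y = enumerated-antidiagonal y x (enumerated-axis (x + y))

tuple : ∀ k → ℕ → Fin k → ℕ
tuple (suc k) n Fin.zero    = proj₁ (unpair n)
tuple (suc k) n (Fin.suc i) = tuple k (proj₂ (unpair n)) i

tuple-surjective : ∀ k (a : Fin k → ℕ) → ∃[ n ] (∀ i → tuple k n i ≡ a i)
tuple-surjective zero    a = 0 , λ ()
tuple-surjective (suc k) a with tuple-surjective k (a ∘ Fin.suc)
... | m , tuple-m≗a with unpair-surjective (a Fin.zero) m
...   | n , unpair-n≡ = n , λ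
  { Fin.zero    → cong proj₁ unpair-n≡
  ; (Fin.suc i) → trans (cong (λ p → tuple k (proj₂ p) i) unpair-n≡) (tuple-m≗a i) }

tableGroup : ∀ {T} → IsGroupTable T → Group 0ℓ 0ℓ
tableGroup {T} isGroupTable = record
  { Carrier = ℕ
  ; _≈_     = _≡_
  ; _∙_     = T
  ; ε       = 0
  ; _⁻¹     = λ x → proj₁ (inverse x)
  ; isGroup = record
    { isMonoid = record
      { isSemigroup = record
        { isMagma = record { isEquivalence = isEquivalence ; ∙-cong = cong₂ T }
        ; assoc   = assoc
        }
      ; identity = identityˡ , identityʳ
      }
    ; inverse = (λ x → proj₂ (proj₂ (inverse x))) , (λ x → proj₁ (proj₂ (inverse x)))
    ; ⁻¹-cong = cong (λ x → proj₁ (inverse x))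
    }
  }
  where open IsGroupTable isGroupTable

Word : ℕ → Set
Word k = List (Fin k × Bool)

evalIn : ∀ {T} → IsGroupTable T → ∀ {k} → (Fin k → ℕ) → Word k → ℕ
evalIn isGroupTable = evalWord (tableGroup isGroupTable)

inverseIn : ∀ {T} → IsGroupTable T → ℕ → ℕ
inverseIn isGroupTable = Group._⁻¹ (tableGroup isGroupTable)

module MagmaHomomorphismOfGroups
  {c₁ ℓ₁ c₂ ℓ₂} (H : Group c₁ ℓ₁) (K : Group c₂ ℓ₂)
  {f : Group.Carrier H → Group.Carrier K}
  (isHomomorphism : IsMagmaHomomorphism (Group.rawMagma H) (Group.rawMagma K) f)
  where

  open Group H using ()
    renaming (_∙_ to _∙₁_; ε to ε₁; _⁻¹ to _⁻¹₁; inverseʳ to inverseʳ₁; identityˡ to identityˡ₁)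
  open Group K using (Carrier; _≈_; _∙_; ε; _⁻¹; setoid; ∙-cong; ⁻¹-cong)
    renaming (trans to ≈-trans)
  open GroupProperties K using (identityˡ-unique; inverseʳ-unique)
  open IsMagmaHomomorphism isHomomorphism
  open SetoidReasoning setoid

  ε-homo : f ε₁ ≈ ε
  ε-homo = identityˡ-unique (f ε₁) (f ε₁) (begin
    f ε₁ ∙ f ε₁  ≈⟨ homo ε₁ ε₁ ⟨
    f (ε₁ ∙₁ ε₁) ≈⟨ ⟦⟧-cong (identityˡ₁ ε₁) ⟩
    f ε₁         ∎)

  ⁻¹-homo : ∀ x → f (x ⁻¹₁) ≈ f x ⁻¹
  ⁻¹-homo x = inverseʳ-unique (f x) (f (x ⁻¹₁)) (begin
    f x ∙ f (x ⁻¹₁)  ≈⟨ homo x (x ⁻¹₁) ⟨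
    f (x ∙₁ x ⁻¹₁)   ≈⟨ ⟦⟧-cong (inverseʳ₁ x) ⟩
    f ε₁             ≈⟨ ε-homo ⟩
    ε                ∎)

  evalWord-homo : ∀ {k} {g : Fin k → Group.Carrier H} {h : Fin k → Carrier} →
    (∀ i → f (g i) ≈ h i) → ∀ w → f (evalWord H g w) ≈ evalWord K h w
  evalWord-homo f∘g≈h []                = ε-homo
  evalWord-homo f∘g≈h ((i , true)  ∷ w) = ≈-trans (homo _ _)
    (∙-cong (f∘g≈h i) (evalWord-homo f∘g≈h w))
  evalWord-homo f∘g≈h ((i , false) ∷ w) = ≈-trans (homo _ _)
    (∙-cong (≈-trans (⁻¹-homo _) (⁻¹-cong (f∘g≈h i))) (evalWord-homo f∘g≈h w))

Eventually : ∀ {a} → (ℕ → Set a) → Set a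
Eventually P = ∃[ m ] (∀ {n} → m ≤ n → P n)

module _ {a b} {P : ℕ → Set a} {Q : ℕ → Set b} where

  eventually-map : (∀ {n} → P n → Q n) → Eventually P → Eventually Q
  eventually-map P⇒Q (m , p) = m , P⇒Q ∘ p

  eventually-× : Eventually P → Eventually Q → Eventually (λ n → P n × Q n)
  eventually-× (m , p) (m′ , q) =
    m ⊔ m′ , λ le → p (≤-trans (m≤m⊔n m m′) le) , q (≤-trans (m≤n⊔m m m′) le)

eventually-witness : ∀ {a} {P : ℕ → Set a} → Eventually P → ∃ P
eventually-witness (m , p) = m , p ≤-refl

-- Sₙ → T in 𝒢, with the rate normalised so that Sₙ agrees with T on {0,…,n-1}².
module Convergence {T : Table} (isGroupTableT : IsGroupTable T)
  (S : ℕ → Table) (isGroupTableS : ∀ n → IsGroupTable (S n)) (S→T : ∀ n → AgreeOn n (S n) T)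
  where

  entry-eventually : ∀ x y → Eventually (λ n → S n x y ≡ T x y)
  entry-eventually x y = suc (x ⊔ y) , λ le →
    S→T _ x y (≤-trans (s≤s (m≤m⊔n x y)) le) (≤-trans (s≤s (m≤n⊔m x y)) le)

  inverse-eventually : ∀ x →
    Eventually (λ n → inverseIn (isGroupTableS n) x ≡ inverseIn isGroupTableT x)
  inverse-eventually x = eventually-map
    (λ {n} Sₙ-entry≡T-entry → sym (GroupProperties.inverseʳ-unique (tableGroup (isGroupTableS n))
      x x⁻¹ (trans Sₙ-entry≡T-entry (Group.inverseʳ (tableGroup isGroupTableT) x))))
    (entry-eventually x x⁻¹)
    where
    x⁻¹ : ℕ
    x⁻¹ = inverseIn isGroupTableT x

  evalIn-eventually : ∀ {k} (a : Fin k → ℕ) w →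
    Eventually (λ n → evalIn (isGroupTableS n) a w ≡ evalIn isGroupTableT a w)
  evalIn-eventually a []               = 0 , λ _ → refl
  evalIn-eventually a ((i , true) ∷ w) = eventually-map
    (λ {n} (Sₙ-entry≡T-entry , w-converges) → trans (cong (S n (a i)) w-converges) Sₙ-entry≡T-entry)
    (eventually-× (entry-eventually (a i) (evalIn isGroupTableT a w)) (evalIn-eventually a w))
  evalIn-eventually a ((i , false) ∷ w) = eventually-map
    (λ {n} (inverse-converges , Sₙ-entry≡T-entry , w-converges) →
      trans (cong₂ (S n) inverse-converges w-converges) Sₙ-entry≡T-entry)
    (eventually-× (inverse-eventually (a i))
      (eventually-× (entry-eventually (inverseIn isGroupTableT (a i)) (evalIn isGroupTableT a w))
                    (evalIn-eventually a w)))

module _ {c ℓ} (H : Group c ℓ) {k} (g : Fin k → Group.Carrier H) where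
  open Group H using (Carrier; _≈_; _∙_)

  EmbeddingSending : (Fin k → ℕ) → Table → Set (c ⊔ˡ ℓ)
  EmbeddingSending a T = Σ (Carrier → ℕ) λ f → IsEmbeddingInto H T f × (∀ i → f (g i) ≡ a i)

  embeddingSending-closed : (∀ x → ∃[ w ] (x ≈ evalWord H g w)) →
    ∀ a → IsClosedIn𝒢 (EmbeddingSending a)
  embeddingSending-closed generates a T isGroupTableT approximants = f , isEmbedding , f∘g≗a
    where
    S : ℕ → Table
    S n = proj₁ (approximants n)
    isGroupTableS : ∀ n → IsGroupTable (S n)
    isGroupTableS n = proj₁ (proj₂ (approximants n))
    fₙ : ℕ → Carrier → ℕ
    fₙ n = proj₁ (proj₁ (proj₂ (proj₂ (approximants n))))
    isEmbeddingₙ : ∀ n → IsEmbeddingInto H (S n) (fₙ n)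
    isEmbeddingₙ n = proj₁ (proj₂ (proj₁ (proj₂ (proj₂ (approximants n)))))
    fₙ∘g≗a : ∀ n i → fₙ n (g i) ≡ a i
    fₙ∘g≗a n = proj₂ (proj₂ (proj₁ (proj₂ (proj₂ (approximants n)))))

    open Convergence isGroupTableT S isGroupTableS (λ n → proj₂ (proj₂ (proj₂ (approximants n))))
    module Eₙ n = IsEmbeddingInto (isEmbeddingₙ n)

    word : Carrier → Word k
    word x = proj₁ (generates x)

    f : Carrier → ℕ
    f x = evalIn isGroupTableT a (word x)

    fₙ-eventually : ∀ x → Eventually (λ n → fₙ n x ≡ f x)
    fₙ-eventually x = eventually-map (λ {n} → trans (fₙ-on-word n)) (evalIn-eventually a (word x))
      where
      fₙ-on-word : ∀ n → fₙ n x ≡ evalIn (isGroupTableS n) a (word x)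
      fₙ-on-word n = trans (Eₙ.respects n (proj₂ (generates x)))
        (MagmaHomomorphismOfGroups.evalWord-homo H (tableGroup (isGroupTableS n))
          (record { isRelHomomorphism = record { cong = Eₙ.respects n } ; homo = Eₙ.homo n })
          (fₙ∘g≗a n) (word x))

    at-some-stage : ∀ x y → ∃[ n ] (fₙ n x ≡ f x × fₙ n y ≡ f y)
    at-some-stage x y = eventually-witness (eventually-× (fₙ-eventually x) (fₙ-eventually y))

    respects : ∀ {x y} → x ≈ y → f x ≡ f y
    respects {x} {y} x≈y with at-some-stage x y
    ... | n , fₙx≡fx , fₙy≡fy = trans (sym fₙx≡fx) (trans (Eₙ.respects n x≈y) fₙy≡fy)

    injective : ∀ {x y} → f x ≡ f y → x ≈ y
    injective {x} {y} fx≡fy with at-some-stage x y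
    ... | n , fₙx≡fx , fₙy≡fy = Eₙ.injective n (trans fₙx≡fx (trans fx≡fy (sym fₙy≡fy)))

    homo : ∀ x y → f (x ∙ y) ≡ T (f x) (f y)
    homo x y with eventually-witness (eventually-× (fₙ-eventually (x ∙ y))
      (eventually-× (entry-eventually (f x) (f y)) (eventually-× (fₙ-eventually x) (fₙ-eventually y))))
    ... | n , fₙxy≡fxy , Sₙ-entry≡T-entry , fₙx≡fx , fₙy≡fy = begin
      f (x ∙ y)             ≡⟨ fₙxy≡fxy ⟨
      fₙ n (x ∙ y)          ≡⟨ Eₙ.homo n x y ⟩
      S n (fₙ n x) (fₙ n y) ≡⟨ cong₂ (S n) fₙx≡fx fₙy≡fy ⟩
      S n (f x) (f y)       ≡⟨ Sₙ-entry≡T-entry ⟩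
      T (f x) (f y)         ∎
      where open ≡-Reasoning

    isEmbedding : IsEmbeddingInto H T f
    isEmbedding = record { respects = respects ; homo = homo ; injective = injective }

    f∘g≗a : ∀ i → f (g i) ≡ a i
    f∘g≗a i with eventually-witness (fₙ-eventually (g i))
    ... | n , fₙgᵢ≡fgᵢ = trans (sym fₙgᵢ≡fgᵢ) (fₙ∘g≗a n i)

mainTheorem20 : (lem : ∀ {a} → ExcludedMiddle a) →
    ∀ {c ℓ} (H : Group c ℓ) → FinitelyGenerated H → IsFσIn𝒢 (ℰ H)
mainTheorem20 _ H (k , g , generates) =
  C , (λ n → embeddingSending-closed H g generates (tuple k n)) , λ T _ → mk⇔ toC fromC
  where
  C : ℕ → Table → Set _
  C n = EmbeddingSending H g (tuple k n)

  toC : ∀ {T} → ℰ H T → ∃[ n ] C n T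
  toC (f , isEmbedding) with tuple-surjective k (f ∘ g)
  ... | n , tuple-n≗f∘g = n , f , isEmbedding , sym ∘ tuple-n≗f∘g

  fromC : ∀ {T} → ∃[ n ] C n T → ℰ H T
  fromC (_ , f , isEmbedding , _) = f , isEmbedding
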